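{- Let $M$ be a $3$-connected matroid such that $r(M),r^*(M)\ge4$, and let $N$ be a $3$-connected minor of $M$ with at most three elements. Then every elastic element of $M$ is $N$-elastic.
   Context: An element $x$ of a $3$-connected matroid $M$ is elastic if ${\rm si}(M/x)$ and ${\rm co}(M\backslash x)$ (simplification and cosimplification) are both $3$-connected; it is $N$-elastic if both are $3$-connected and each has an $N$-minor. -}

module Defs where

open import Data.Nat using (ℕ; _+_; _∸_; _≤_)
open import Data.Fin using (Fin)
open import Data.Fin.Subset using (Subset; _∈_; _∉_; _⊆_; _∪_; _∩_; _─_; ∁; ⁅_⁆; ∣_∣; ⊤; ⊥)
open import Data.Vec using (tabulate; lookup)
open import Data.Product using (Σ; _×_; ∃)
open import Data.Sum using (_⊎_)
open import Function.Definitions using (Injective)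
open import Relation.Binary.PropositionalEquality using (_≡_)
open import Relation.Nullary using (¬_)

record Matroid (n : ℕ) : Set where
  field
    rank       : Subset n → ℕ
    rank-bound : ∀ X → rank X ≤ ∣ X ∣
    rank-mono  : ∀ {X Y} → X ⊆ Y → rank X ≤ rank Y
    rank-submod : ∀ X Y → rank (X ∪ Y) + rank (X ∩ Y) ≤ rank X + rank Y
open Matroid public

-- A "rank system": a ground set E ⊆ Fin n together with a rank function
-- (only evaluated on subsets of E).  All minors / duals of a matroid on
-- Fin n are represented this way, without re-indexing the ground set.
record RankSys (n : ℕ) : Set where
  constructor sys
  field
    E : Subset n
    ρ : Subset n → ℕ
open RankSys public

toSys : ∀ {n} → Matroid n → RankSys n
toSys M = sys ⊤ (rank M)

contract : ∀ {n} → Subset n → RankSys n → RankSys n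
contract C S = sys (E S ─ C) (λ X → ρ S (X ∪ C) ∸ ρ S C)

delete : ∀ {n} → Subset n → RankSys n → RankSys n
delete D S = sys (E S ─ D) (ρ S)

dual : ∀ {n} → RankSys n → RankSys n
dual S = sys (E S) (λ X → ∣ X ∣ + ρ S (E S ─ X) ∸ ρ S (E S))

r : ∀ {n} → RankSys n → ℕ
r S = ρ S (E S)

-- Tutte connectivity: S is 3-connected iff it has no k-separation for k < 3,
-- i.e. for every partition (X , E - X) and k ∈ {1,2} with |X|,|E - X| ≥ k,
-- r(X) + r(E - X) - r(E) ≥ k.
ThreeConnected : ∀ {n} → RankSys n → Set
ThreeConnected S = ∀ X → X ⊆ E S → ∀ k → 1 ≤ k → k ≤ 2 →
  k ≤ ∣ X ∣ → k ≤ ∣ E S ─ X ∣ → ρ S (E S) + k ≤ ρ S X + ρ S (E S ─ X)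

Loop : ∀ {n} → RankSys n → Fin n → Set
Loop S e = ρ S ⁅ e ⁆ ≡ 0

Parallel : ∀ {n} → RankSys n → Fin n → Fin n → Set
Parallel S e f = ¬ (e ≡ f) × ρ S ⁅ e ⁆ ≡ 1 × ρ S ⁅ f ⁆ ≡ 1 × ρ S (⁅ e ⁆ ∪ ⁅ f ⁆) ≡ 1

-- K is the set of kept elements of a simplification of S: K contains no loops
-- and exactly one element of each parallel class.  si(S) = S \ (E - K).
IsSimplification : ∀ {n} → RankSys n → Subset n → Set
IsSimplification {n} S K =
  K ⊆ E S ×
  (∀ e → e ∈ K → ¬ Loop S e) ×
  (∀ e f → e ∈ K → f ∈ K → ¬ Parallel S e f) ×
  (∀ e → e ∈ E S → ¬ Loop S e → e ∈ K ⊎ Σ (Fin n) (λ f → f ∈ K × Parallel S e f))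

si : ∀ {n} → RankSys n → Subset n → RankSys n
si S K = delete (E S ─ K) S

-- K is the kept set of a cosimplification of S, i.e. of a simplification of S*;
-- co(S) = (si(S*))* = S / (E - K).
IsCosimplification : ∀ {n} → RankSys n → Subset n → Set
IsCosimplification S K = IsSimplification (dual S) K

co : ∀ {n} → RankSys n → Subset n → RankSys n
co S K = contract (E S ─ K) S

preimage : ∀ {m n} → (Fin m → Fin n) → Subset n → Subset m
preimage f X = tabulate (λ i → lookup X (f i))

-- S has an N-minor: there are disjoint C, D ⊆ E(S) and a bijection
-- f : E(N) = Fin m → E(S) - (C ∪ D) which is an isomorphism N ≅ S / C \ D.
HasMinor : ∀ {m n} → RankSys n → Matroid m → Set
HasMinor {m} {n} S N =
  Σ (Subset n) λ C → Σ (Subset n) λ D →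
  C ⊆ E S × D ⊆ E S × (∀ e → e ∈ C → e ∉ D) ×
  Σ (Fin m → Fin n) λ f →
    Injective _≡_ _≡_ f ×
    (∀ i → f i ∈ (E S ─ (C ∪ D))) ×
    (∀ e → e ∈ (E S ─ (C ∪ D)) → ∃ λ i → f i ≡ e) ×
    (∀ X → X ⊆ (E S ─ (C ∪ D)) → rank N (preimage f X) + ρ S C ≡ ρ S (X ∪ C))

Elastic : ∀ {n} → Matroid n → Fin n → Set
Elastic M x =
  (∃ λ K → IsSimplification (contract ⁅ x ⁆ (toSys M)) K ×
           ThreeConnected (si (contract ⁅ x ⁆ (toSys M)) K)) ×
  (∃ λ K → IsCosimplification (delete ⁅ x ⁆ (toSys M)) K ×
           ThreeConnected (co (delete ⁅ x ⁆ (toSys M)) K))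

NElastic : ∀ {m n} → Matroid m → Matroid n → Fin n → Set
NElastic N M x =
  (∃ λ K → IsSimplification (contract ⁅ x ⁆ (toSys M)) K ×
           ThreeConnected (si (contract ⁅ x ⁆ (toSys M)) K) ×
           HasMinor (si (contract ⁅ x ⁆ (toSys M)) K) N) ×
  (∃ λ K → IsCosimplification (delete ⁅ x ⁆ (toSys M)) K ×
           ThreeConnected (co (delete ⁅ x ⁆ (toSys M)) K) ×
           HasMinor (co (delete ⁅ x ⁆ (toSys M)) K) N)

-- A 3-connected matroid N on at most three elements is uniform, and of one of two kinds:
-- U(1,m), which a 3-connected S with at least four elements has as a minor by contracting a
-- hyperplane H (3-connectivity forces |E − H| ≥ 3) and keeping m elements off H; or U(m−1,m),
-- obtained by contracting all but m elements of a circuit (3-connectivity forces circuits of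
-- size ≥ 3).  So it suffices that si(M/x) and co(M\x) have at least four elements.  The rank
-- of si(M/x) is r(M/x) ≥ r(M) − 1 ≥ 3 because a simplification spans, and a 3-connected
-- system with at least two elements has rank below its size; dually for co(M\x).

module Submission where

open import Data.Bool using (true; false)
open import Data.Empty using (⊥-elim)
open import Data.Fin using (Fin; zero; suc)
open import Data.Fin.Properties using (any?)
open import Data.Fin.Subset
open import Data.Fin.Subset.Properties
open import Data.Nat using (ℕ; zero; suc; _+_; _∸_; _≤_; _<_; _⊓_; z≤n; s≤s; _≟_; _<?_)
open import Data.Nat.Induction using (<-wellFounded)
open import Data.Nat.Properties
open import Data.Nat.Solver using (module +-*-Solver)
open import Data.Product using (_×_; ∃; _,_; proj₁; proj₂)
open import Data.Sum using (_⊎_; inj₁; inj₂; [_,_])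
open import Data.Vec using ([]; _∷_; here; there)
open import Data.Vec.Properties using (lookup∘tabulate; lookup⇒[]=; []=⇒lookup)
import Data.Vec.Functional as Vecᶠ
open import Function using (_on_; _∘_)
open import Function.Definitions using (Injective)
open import Induction.WellFounded using (WellFounded; Acc; acc)
open import Relation.Binary.PropositionalEquality hiding ([_])
import Relation.Binary.Construct.On as On
open import Relation.Nullary using (¬_; yes; no; _×-dec_)
open import Relation.Unary using (Decidable)

open import Defs

open +-*-Solver using (solve; _:+_; _:=_)

private variable
  m n : ℕ
  x : Fin n

x∈p─q⁻ : ∀ (p q : Subset n) → x ∈ p ─ q → x ∈ p × x ∉ q
x∈p─q⁻ (true ∷ p) (false ∷ q) here = here , λ ()
x∈p─q⁻ {x = zero} (true ∷ p) (true ∷ q) ()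
x∈p─q⁻ {x = zero} (false ∷ p) (true ∷ q) ()
x∈p─q⁻ {x = zero} (false ∷ p) (false ∷ q) ()
x∈p─q⁻ (_ ∷ p) (_ ∷ q) (there x∈p─q) with x∈p─q⁻ p q x∈p─q
... | x∈p , x∉q = there x∈p , λ { (there x∈q) → x∉q x∈q }

p─[p─q]≡q : ∀ {p q : Subset n} → q ⊆ p → p ─ (p ─ q) ≡ q
p─[p─q]≡q {p = p} {q} q⊆p = ⊆-antisym ⊆q q⊆
  where
  ⊆q : p ─ (p ─ q) ⊆ q
  ⊆q {x} x∈ with x ∈? q | x∈p─q⁻ p (p ─ q) x∈
  ... | yes x∈q | _ = x∈q
  ... | no x∉q | x∈p , x∉p─q = ⊥-elim (x∉p─q (x∈p∧x∉q⇒x∈p─q x∈p x∉q))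
  q⊆ : q ⊆ p ─ (p ─ q)
  q⊆ x∈q = x∈p∧x∉q⇒x∈p─q (q⊆p x∈q) (λ x∈p─q → proj₂ (x∈p─q⁻ p q x∈p─q) x∈q)

∣p∣≡∣q∣+∣p─q∣ : ∀ (p q : Subset n) → q ⊆ p → ∣ p ∣ ≡ ∣ q ∣ + ∣ p ─ q ∣
∣p∣≡∣q∣+∣p─q∣ [] [] _ = refl
∣p∣≡∣q∣+∣p─q∣ (_ ∷ p) (true ∷ q) q⊆p with q⊆p here
... | here = cong suc (∣p∣≡∣q∣+∣p─q∣ p q (drop-∷-⊆ q⊆p))
∣p∣≡∣q∣+∣p─q∣ (true ∷ p) (false ∷ q) q⊆p =
  trans (cong suc (∣p∣≡∣q∣+∣p─q∣ p q (drop-∷-⊆ q⊆p))) (sym (+-suc ∣ q ∣ ∣ p ─ q ∣))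
∣p∣≡∣q∣+∣p─q∣ (false ∷ p) (false ∷ q) q⊆p = ∣p∣≡∣q∣+∣p─q∣ p q (drop-∷-⊆ q⊆p)

∣p∪q∣≡∣p∣+∣q∣ : ∀ (p q : Subset n) → (∀ {x} → x ∈ p → x ∉ q) → ∣ p ∪ q ∣ ≡ ∣ p ∣ + ∣ q ∣
∣p∪q∣≡∣p∣+∣q∣ [] [] _ = refl
∣p∪q∣≡∣p∣+∣q∣ (true ∷ p) (true ∷ q) disj = ⊥-elim (disj here here)
∣p∪q∣≡∣p∣+∣q∣ (true ∷ p) (false ∷ q) disj = cong suc (∣p∪q∣≡∣p∣+∣q∣ p q λ a b → disj (there a) (there b))
∣p∪q∣≡∣p∣+∣q∣ (false ∷ p) (true ∷ q) disj =
  trans (cong suc (∣p∪q∣≡∣p∣+∣q∣ p q λ a b → disj (there a) (there b))) (sym (+-suc ∣ p ∣ ∣ q ∣))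
∣p∪q∣≡∣p∣+∣q∣ (false ∷ p) (false ∷ q) disj = ∣p∪q∣≡∣p∣+∣q∣ p q λ a b → disj (there a) (there b)

∣p∪q∣+∣p∩q∣≡∣p∣+∣q∣ : ∀ (p q : Subset n) → ∣ p ∪ q ∣ + ∣ p ∩ q ∣ ≡ ∣ p ∣ + ∣ q ∣
∣p∪q∣+∣p∩q∣≡∣p∣+∣q∣ [] [] = refl
∣p∪q∣+∣p∩q∣≡∣p∣+∣q∣ (true ∷ p) (true ∷ q) = cong suc (begin
  ∣ p ∪ q ∣ + suc ∣ p ∩ q ∣ ≡⟨ +-suc ∣ p ∪ q ∣ ∣ p ∩ q ∣ ⟩
  suc (∣ p ∪ q ∣ + ∣ p ∩ q ∣) ≡⟨ cong suc (∣p∪q∣+∣p∩q∣≡∣p∣+∣q∣ p q) ⟩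
  suc (∣ p ∣ + ∣ q ∣) ≡⟨ +-suc ∣ p ∣ ∣ q ∣ ⟨
  ∣ p ∣ + suc ∣ q ∣ ∎)
  where open ≡-Reasoning
∣p∪q∣+∣p∩q∣≡∣p∣+∣q∣ (true ∷ p) (false ∷ q) = cong suc (∣p∪q∣+∣p∩q∣≡∣p∣+∣q∣ p q)
∣p∪q∣+∣p∩q∣≡∣p∣+∣q∣ (false ∷ p) (true ∷ q) =
  trans (cong suc (∣p∪q∣+∣p∩q∣≡∣p∣+∣q∣ p q)) (sym (+-suc ∣ p ∣ ∣ q ∣))
∣p∪q∣+∣p∩q∣≡∣p∣+∣q∣ (false ∷ p) (false ∷ q) = ∣p∪q∣+∣p∩q∣≡∣p∣+∣q∣ p q

x∈p⇒⁅x⁆⊆p : ∀ {p : Subset n} → x ∈ p → ⁅ x ⁆ ⊆ p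
x∈p⇒⁅x⁆⊆p {x = x} {p} x∈p y∈⁅x⁆ = subst (_∈ p) (sym (x∈⁅y⁆⇒x≡y x y∈⁅x⁆)) x∈p

x∈p⇒∣p∣≡1+∣p-x∣ : ∀ {p : Subset n} → x ∈ p → ∣ p ∣ ≡ suc ∣ p - x ∣
x∈p⇒∣p∣≡1+∣p-x∣ {x = x} {p} x∈p =
  trans (∣p∣≡∣q∣+∣p─q∣ p ⁅ x ⁆ (x∈p⇒⁅x⁆⊆p x∈p)) (cong (_+ ∣ p - x ∣) (∣⁅x⁆∣≡1 x))

Empty⇒∣p∣≡0 : ∀ {p : Subset n} → Empty p → ∣ p ∣ ≡ 0
Empty⇒∣p∣≡0 {n} ∅ = trans (cong ∣_∣ (Empty-unique ∅)) (∣⊥∣≡0 n)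

1≤∣p∣⇒Nonempty : ∀ {p : Subset n} → 1 ≤ ∣ p ∣ → Nonempty p
1≤∣p∣⇒Nonempty {p = p} 1≤∣p∣ with nonempty? p
... | yes ne = ne
... | no ∅ = ⊥-elim (1+n≰n (subst (1 ≤_) (Empty⇒∣p∣≡0 ∅) 1≤∣p∣))

∪-lub : ∀ {p q r : Subset n} → p ⊆ r → q ⊆ r → p ∪ q ⊆ r
∪-lub {p = p} {q} p⊆r q⊆r x∈p∪q with x∈p∪q⁻ p q x∈p∪q
... | inj₁ x∈p = p⊆r x∈p
... | inj₂ x∈q = q⊆r x∈q

p⊆q∪[p─q] : ∀ (p q : Subset n) → p ⊆ q ∪ (p ─ q)
p⊆q∪[p─q] p q {x} x∈p with x ∈? q
... | yes x∈q = p⊆p∪q (p ─ q) x∈q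
... | no x∉q = q⊆p∪q q (p ─ q) (x∈p∧x∉q⇒x∈p─q x∈p x∉q)

x≡y⇒x∈⁅y⁆ : ∀ {y : Fin n} → x ≡ y → x ∈ ⁅ y ⁆
x≡y⇒x∈⁅y⁆ refl = x∈⁅x⁆ _

Empty[p─q]⇒p⊆q : ∀ {p q : Subset n} → Empty (p ─ q) → p ⊆ q
Empty[p─q]⇒p⊆q {p = p} {q} ∅ = ⊆-trans (p⊆q∪[p─q] p q) (∪-lub ⊆-refl λ x∈ → ⊥-elim (∅ (_ , x∈)))

p⊆q∧x∉p⇒p⊆q-x : ∀ {p q : Subset n} → p ⊆ q → x ∉ p → p ⊆ q - x
p⊆q∧x∉p⇒p⊆q-x {p = p} p⊆q x∉p y∈p =
  x∈p∧x∉q⇒x∈p─q (p⊆q y∈p) (x≢y⇒x∉⁅y⁆ λ y≡x → x∉p (subst (_∈ p) y≡x y∈p))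

p─q─[p─r]⊆r─q : ∀ {p q r : Subset n} → q ⊆ r → p ─ q ─ (p ─ r) ⊆ r ─ q
p─q─[p─r]⊆r─q {p = p} {q} {r} q⊆r {x} x∈ with x∈p─q⁻ (p ─ q) (p ─ r) x∈
... | x∈p─q , x∉p─r with x∈p─q⁻ p q x∈p─q
...   | x∈p , x∉q with x ∈? r
...     | yes x∈r = x∈p∧x∉q⇒x∈p─q x∈r x∉q
...     | no x∉r = ⊥-elim (x∉p─r (x∈p∧x∉q⇒x∈p─q x∈p x∉r))

p─[q∪r]⊆[p─q]∩[p─r] : ∀ (p q r : Subset n) → p ─ (q ∪ r) ⊆ (p ─ q) ∩ (p ─ r)
p─[q∪r]⊆[p─q]∩[p─r] p q r x∈ with x∈p─q⁻ p (q ∪ r) x∈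
... | x∈p , x∉q∪r = x∈p∩q⁺ ( x∈p∧x∉q⇒x∈p─q x∈p (λ x∈q → x∉q∪r (p⊆p∪q r x∈q))
                          , x∈p∧x∉q⇒x∈p─q x∈p (λ x∈r → x∉q∪r (q⊆p∪q q r x∈r)))

p─[q∩r]⊆[p─q]∪[p─r] : ∀ (p q r : Subset n) → p ─ (q ∩ r) ⊆ (p ─ q) ∪ (p ─ r)
p─[q∩r]⊆[p─q]∪[p─r] p q r {x} x∈ with x∈p─q⁻ p (q ∩ r) x∈ | x ∈? q
... | x∈p , _      | no x∉q  = p⊆p∪q (p ─ r) (x∈p∧x∉q⇒x∈p─q x∈p x∉q)
... | x∈p , x∉q∩r | yes x∈q = q⊆p∪q (p ─ q) (p ─ r) (x∈p∧x∉q⇒x∈p─q x∈p λ x∈r → x∉q∩r (x∈p∩q⁺ (x∈q , x∈r)))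

size-wellFounded : WellFounded (_<_ on (∣_∣ {n}))
size-wellFounded = On.wellFounded ∣_∣ <-wellFounded

removal-induction : (P : Subset n → Set) → (∀ {p} → Empty p → P p) →
  (∀ {p x} → x ∈ p → P (p - x) → P p) → ∀ p → P p
removal-induction P base step p = go p (size-wellFounded p)
  where
  go : ∀ p → Acc (_<_ on ∣_∣) p → P p
  go p (acc smaller) with nonempty? p
  ... | no ∅ = base ∅
  ... | yes (x , x∈p) = step x∈p (go (p - x) (smaller (x∈p⇒∣p-x∣<∣p∣ x∈p)))

minimal-subset : (P : Subset n → Set) → Decidable P → ∀ {Y} → P Y →
  ∃ λ Z → Z ⊆ Y × P Z × (∀ {z} → z ∈ Z → ¬ P (Z - z))
minimal-subset P P? {Y} PY = go Y (size-wellFounded Y) ⊆-refl PY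
  where
  go : ∀ Z → Acc (_<_ on ∣_∣) Z → Z ⊆ Y → P Z → ∃ λ Z → Z ⊆ Y × P Z × (∀ {z} → z ∈ Z → ¬ P (Z - z))
  go Z (acc smaller) Z⊆Y PZ with any? (λ z → z ∈? Z ×-dec P? (Z - z))
  ... | yes (z , z∈Z , PZ-z) = go (Z - z) (smaller (x∈p⇒∣p-x∣<∣p∣ z∈Z)) (⊆-trans (p─q⊆p Z ⁅ z ⁆) Z⊆Y) PZ-z
  ... | no none = Z , Z⊆Y , PZ , λ z∈Z PZ-z → none (_ , z∈Z , PZ-z)

maximal-subset : (P : Subset n → Set) → Decidable P → ∀ {E Y} → Y ⊆ E → P Y →
  ∃ λ Z → Z ⊆ E × P Z × (∀ {e} → e ∈ E → e ∉ Z → ¬ P (Z ∪ ⁅ e ⁆))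
maximal-subset P P? {E} {Y} Y⊆E PY = go Y (On.wellFounded (λ Z → ∣ E ─ Z ∣) <-wellFounded Y) Y⊆E PY
  where
  go : ∀ Z → Acc (_<_ on (λ Z → ∣ E ─ Z ∣)) Z → Z ⊆ E → P Z →
       ∃ λ Z → Z ⊆ E × P Z × (∀ {e} → e ∈ E → e ∉ Z → ¬ P (Z ∪ ⁅ e ⁆))
  go Z (acc smaller) Z⊆E PZ with any? (λ e → e ∈? E ─ Z ×-dec P? (Z ∪ ⁅ e ⁆))
  ... | yes (e , e∈E─Z , PZ+e) =
    go (Z ∪ ⁅ e ⁆) (smaller (subst (_< ∣ E ─ Z ∣) (cong ∣_∣ (p─q─r≡p─q∪r E Z ⁅ e ⁆)) (x∈p⇒∣p-x∣<∣p∣ e∈E─Z)))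
       (∪-lub Z⊆E (x∈p⇒⁅x⁆⊆p (proj₁ (x∈p─q⁻ E Z e∈E─Z)))) PZ+e
  ... | no none = Z , Z⊆E , PZ , λ e∈E e∉Z PZ+e → none (_ , x∈p∧x∉q⇒x∈p─q e∈E e∉Z , PZ+e)

∸-preserves-sum-≤ : ∀ {z a b c d} → z ≤ a → z ≤ b → z ≤ c → z ≤ d → a + b ≤ c + d →
  (a ∸ z) + (b ∸ z) ≤ (c ∸ z) + (d ∸ z)
∸-preserves-sum-≤ {z} z≤a z≤b z≤c z≤d a+b≤c+d =
  +-cancelʳ-≤ (z + z) _ _ (subst₂ _≤_ (split z≤a z≤b) (split z≤c z≤d) a+b≤c+d)
  where
  split : ∀ {u v} → z ≤ u → z ≤ v → u + v ≡ (u ∸ z) + (v ∸ z) + (z + z)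
  split {u} {v} z≤u z≤v = begin
    u + v                        ≡⟨ cong₂ _+_ (m∸n+n≡m z≤u) (m∸n+n≡m z≤v) ⟨
    (u ∸ z + z) + (v ∸ z + z)    ≡⟨ solve 3 (λ p q z → (p :+ z) :+ (q :+ z) := (p :+ q) :+ (z :+ z))
                                          refl (u ∸ z) (v ∸ z) z ⟩
    (u ∸ z) + (v ∸ z) + (z + z)  ∎
    where open ≡-Reasoning

sum-tight : ∀ {a b c d} → a ≤ c → b ≤ d → c + d ≤ a + b → a ≡ c × b ≡ d
sum-tight {a} {b} {c} {d} a≤c b≤d c+d≤a+b =
  ≤-antisym a≤c (+-cancelʳ-≤ d c a (≤-trans c+d≤a+b (+-monoʳ-≤ a b≤d))) ,
  ≤-antisym b≤d (+-cancelˡ-≤ c d b (≤-trans c+d≤a+b (+-monoˡ-≤ b a≤c)))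

∸-telescope : ∀ {a b c} → b ≤ c → c ≤ a + b → (a + b ∸ c) + (c ∸ b) ≡ a
∸-telescope {a} {b} {c} b≤c c≤a+b = +-cancelʳ-≡ b _ _ (begin
  (a + b ∸ c) + (c ∸ b) + b    ≡⟨ +-assoc (a + b ∸ c) (c ∸ b) b ⟩
  (a + b ∸ c) + ((c ∸ b) + b)  ≡⟨ cong ((a + b ∸ c) +_) (m∸n+n≡m b≤c) ⟩
  (a + b ∸ c) + c              ≡⟨ m∸n+n≡m c≤a+b ⟩
  a + b                        ∎)
  where open ≡-Reasoning

1+m∸n≤1+[m∸n] : ∀ m n → suc m ∸ n ≤ suc (m ∸ n)
1+m∸n≤1+[m∸n] m n = m≤n+o⇒m∸n≤o (suc m) n (subst (suc m ≤_) (sym (+-suc n (m ∸ n))) (s≤s (m≤n+m∸n m n)))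

-- Rank functions

record IsRankFunction (ρ : Subset n → ℕ) : Set where
  field
    bounded    : ∀ X → ρ X ≤ ∣ X ∣
    monotone   : ∀ {X Y} → X ⊆ Y → ρ X ≤ ρ Y
    submodular : ∀ X Y → ρ (X ∪ Y) + ρ (X ∩ Y) ≤ ρ X + ρ Y

  subadditive : ∀ X Y → ρ (X ∪ Y) ≤ ρ X + ρ Y
  subadditive X Y = ≤-trans (m≤m+n _ _) (submodular X Y)

  ρ⁅x⁆≤1 : ∀ x → ρ ⁅ x ⁆ ≤ 1
  ρ⁅x⁆≤1 x = subst (ρ ⁅ x ⁆ ≤_) (∣⁅x⁆∣≡1 x) (bounded ⁅ x ⁆)

  ρ⊥≡0 : ρ ⊥ ≡ 0
  ρ⊥≡0 = n≤0⇒n≡0 (subst (ρ ⊥ ≤_) (∣⊥∣≡0 n) (bounded ⊥))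

  ρ[X∪x]≤ρX+1 : ∀ X x → ρ (X ∪ ⁅ x ⁆) ≤ ρ X + 1
  ρ[X∪x]≤ρX+1 X x = ≤-trans (subadditive X ⁅ x ⁆) (+-monoʳ-≤ (ρ X) (ρ⁅x⁆≤1 x))

  ρX≤ρY+∣X─Y∣ : ∀ X Y → ρ X ≤ ρ Y + ∣ X ─ Y ∣
  ρX≤ρY+∣X─Y∣ X Y = begin
    ρ X                  ≤⟨ monotone (p⊆q∪[p─q] X Y) ⟩
    ρ (Y ∪ (X ─ Y))      ≤⟨ subadditive Y (X ─ Y) ⟩
    ρ Y + ρ (X ─ Y)      ≤⟨ +-monoʳ-≤ (ρ Y) (bounded (X ─ Y)) ⟩
    ρ Y + ∣ X ─ Y ∣      ∎
    where open ≤-Reasoning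

  ρE≤∣X∣+ρ[E─X] : ∀ E X → ρ E ≤ ∣ X ∣ + ρ (E ─ X)
  ρE≤∣X∣+ρ[E─X] E X = begin
    ρ E                ≤⟨ monotone (p⊆q∪[p─q] E X) ⟩
    ρ (X ∪ (E ─ X))    ≤⟨ subadditive X (E ─ X) ⟩
    ρ X + ρ (E ─ X)    ≤⟨ +-monoˡ-≤ (ρ (E ─ X)) (bounded X) ⟩
    ∣ X ∣ + ρ (E ─ X)  ∎
    where open ≤-Reasoning

  independent-⊆ : ∀ {I Y} → ρ I ≡ ∣ I ∣ → Y ⊆ I → ρ Y ≡ ∣ Y ∣
  independent-⊆ {I} {Y} ρI≡∣I∣ Y⊆I = ≤-antisym (bounded Y) (+-cancelʳ-≤ ∣ I ─ Y ∣ _ _ (begin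
    ∣ Y ∣ + ∣ I ─ Y ∣    ≡⟨ ∣p∣≡∣q∣+∣p─q∣ I Y Y⊆I ⟨
    ∣ I ∣               ≡⟨ ρI≡∣I∣ ⟨
    ρ I                 ≤⟨ ρX≤ρY+∣X─Y∣ I Y ⟩
    ρ Y + ∣ I ─ Y ∣      ∎))
    where open ≤-Reasoning

matroid-isRankFunction : (M : Matroid n) → IsRankFunction (rank M)
matroid-isRankFunction M = record
  { bounded = rank-bound M ; monotone = rank-mono M ; submodular = rank-submod M }

contraction-isRankFunction : ∀ {ρ : Subset n → ℕ} → IsRankFunction ρ → ∀ C →
  IsRankFunction (λ X → ρ (X ∪ C) ∸ ρ C)
contraction-isRankFunction {ρ = ρ} R C = record
  { bounded = λ X → m≤n+o⇒m∸n≤o (ρ (X ∪ C)) (ρ C) (begin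
      ρ (X ∪ C)    ≤⟨ subadditive X C ⟩
      ρ X + ρ C    ≤⟨ +-monoˡ-≤ (ρ C) (bounded X) ⟩
      ∣ X ∣ + ρ C  ≡⟨ +-comm ∣ X ∣ (ρ C) ⟩
      ρ C + ∣ X ∣  ∎)
  ; monotone = λ {X} {Y} X⊆Y → ∸-monoˡ-≤ (ρ C) (monotone (∪-lub (⊆-trans X⊆Y (p⊆p∪q C)) (q⊆p∪q Y C)))
  ; submodular = λ X Y → ∸-preserves-sum-≤ (ρC≤ _) (ρC≤ _) (ρC≤ _) (ρC≤ _) (begin
      ρ ((X ∪ Y) ∪ C) + ρ ((X ∩ Y) ∪ C)
        ≤⟨ +-mono-≤ (monotone (∪-lub (∪-lub (⊆-trans (p⊆p∪q C) (p⊆p∪q (Y ∪ C)))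
                                              (⊆-trans (p⊆p∪q C) (q⊆p∪q (X ∪ C) (Y ∪ C))))
                                       (⊆-trans (q⊆p∪q X C) (p⊆p∪q (Y ∪ C)))))
                    (≤-reflexive (cong ρ (∪-distribʳ-∩ C X Y))) ⟩
      ρ ((X ∪ C) ∪ (Y ∪ C)) + ρ ((X ∪ C) ∩ (Y ∪ C))
        ≤⟨ submodular (X ∪ C) (Y ∪ C) ⟩
      ρ (X ∪ C) + ρ (Y ∪ C) ∎)
  }
  where
  open IsRankFunction R
  open ≤-Reasoning
  ρC≤ : ∀ X → ρ C ≤ ρ (X ∪ C)
  ρC≤ X = monotone (q⊆p∪q X C)

dual-isRankFunction : ∀ {ρ : Subset n → ℕ} → IsRankFunction ρ → ∀ E →
  IsRankFunction (λ X → ∣ X ∣ + ρ (E ─ X) ∸ ρ E)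
dual-isRankFunction {ρ = ρ} R E = record
  { bounded = λ X → m≤n+o⇒m∸n≤o _ (ρ E) (begin
      ∣ X ∣ + ρ (E ─ X)  ≤⟨ +-monoʳ-≤ ∣ X ∣ (monotone (p─q⊆p E X)) ⟩
      ∣ X ∣ + ρ E        ≡⟨ +-comm ∣ X ∣ (ρ E) ⟩
      ρ E + ∣ X ∣        ∎)
  ; monotone = λ {X} {Y} X⊆Y → ∸-monoˡ-≤ (ρ E) (begin
      ∣ X ∣ + ρ (E ─ X)                   ≤⟨ +-monoʳ-≤ ∣ X ∣ (ρX≤ρY+∣X─Y∣ (E ─ X) (E ─ Y)) ⟩
      ∣ X ∣ + (ρ (E ─ Y) + ∣ E ─ X ─ (E ─ Y) ∣)
                                          ≤⟨ +-monoʳ-≤ ∣ X ∣ (+-monoʳ-≤ (ρ (E ─ Y))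
                                               (p⊆q⇒∣p∣≤∣q∣ (p─q─[p─r]⊆r─q {p = E} X⊆Y))) ⟩
      ∣ X ∣ + (ρ (E ─ Y) + ∣ Y ─ X ∣)     ≡⟨ solve 3 (λ a b c → a :+ (b :+ c) := (a :+ c) :+ b)
                                               refl (∣ X ∣) (ρ (E ─ Y)) (∣ Y ─ X ∣) ⟩
      (∣ X ∣ + ∣ Y ─ X ∣) + ρ (E ─ Y)     ≡⟨ cong (_+ ρ (E ─ Y)) (∣p∣≡∣q∣+∣p─q∣ Y X X⊆Y) ⟨
      ∣ Y ∣ + ρ (E ─ Y)                   ∎)
  ; submodular = λ X Y → ∸-preserves-sum-≤ (ρE≤ _) (ρE≤ _) (ρE≤ _) (ρE≤ _) (begin
      (∣ X ∪ Y ∣ + ρ (E ─ (X ∪ Y))) + (∣ X ∩ Y ∣ + ρ (E ─ (X ∩ Y)))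
        ≡⟨ interchange (∣ X ∪ Y ∣) _ (∣ X ∩ Y ∣) _ ⟩
      (∣ X ∪ Y ∣ + ∣ X ∩ Y ∣) + (ρ (E ─ (X ∪ Y)) + ρ (E ─ (X ∩ Y)))
        ≤⟨ +-mono-≤ (≤-reflexive (∣p∪q∣+∣p∩q∣≡∣p∣+∣q∣ X Y)) (begin
             ρ (E ─ (X ∪ Y)) + ρ (E ─ (X ∩ Y))
               ≤⟨ +-mono-≤ (monotone (p─[q∪r]⊆[p─q]∩[p─r] E X Y)) (monotone (p─[q∩r]⊆[p─q]∪[p─r] E X Y)) ⟩
             ρ ((E ─ X) ∩ (E ─ Y)) + ρ ((E ─ X) ∪ (E ─ Y))
               ≡⟨ +-comm (ρ ((E ─ X) ∩ (E ─ Y))) _ ⟩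
             ρ ((E ─ X) ∪ (E ─ Y)) + ρ ((E ─ X) ∩ (E ─ Y))
               ≤⟨ submodular (E ─ X) (E ─ Y) ⟩
             ρ (E ─ X) + ρ (E ─ Y) ∎) ⟩
      (∣ X ∣ + ∣ Y ∣) + (ρ (E ─ X) + ρ (E ─ Y))
        ≡⟨ interchange (∣ X ∣) (∣ Y ∣) _ _ ⟩
      (∣ X ∣ + ρ (E ─ X)) + (∣ Y ∣ + ρ (E ─ Y)) ∎)
  }
  where
  open IsRankFunction R
  open ≤-Reasoning
  ρE≤ : ∀ X → ρ E ≤ ∣ X ∣ + ρ (E ─ X)
  ρE≤ = ρE≤∣X∣+ρ[E─X] E
  interchange : ∀ a b c d → (a + b) + (c + d) ≡ (a + c) + (b + d)
  interchange = solve 4 (λ a b c d → (a :+ b) :+ (c :+ d) := (a :+ c) :+ (b :+ d)) refl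

module _ {S : RankSys n} (R : IsRankFunction (ρ S)) where
  open IsRankFunction R
  open ≤-Reasoning

  simplification-absorbs : ∀ {K} → IsSimplification S K → ∀ {e} → e ∈ E S → ρ S (K ∪ ⁅ e ⁆) ≤ ρ S K
  simplification-absorbs {K} (_ , _ , _ , covered) {e} e∈E with ρ S ⁅ e ⁆ ≟ 0
  ... | yes loop = begin
    ρ S (K ∪ ⁅ e ⁆)       ≤⟨ subadditive K ⁅ e ⁆ ⟩
    ρ S K + ρ S ⁅ e ⁆     ≡⟨ cong (ρ S K +_) loop ⟩
    ρ S K + 0             ≡⟨ +-identityʳ (ρ S K) ⟩
    ρ S K                 ∎
  ... | no nonloop with covered e e∈E nonloop
  ... | inj₁ e∈K = monotone (∪-lub ⊆-refl (x∈p⇒⁅x⁆⊆p e∈K))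
  ... | inj₂ (f , f∈K , _ , _ , ρf≡1 , ρef≡1) = +-cancelʳ-≤ 1 _ _ (begin
    ρ S (K ∪ ⁅ e ⁆) + 1
      ≡⟨ cong (ρ S (K ∪ ⁅ e ⁆) +_) ρf≡1 ⟨
    ρ S (K ∪ ⁅ e ⁆) + ρ S ⁅ f ⁆
      ≤⟨ +-mono-≤ (monotone (∪-lub (p⊆p∪q _) (⊆-trans (p⊆p∪q ⁅ f ⁆) (q⊆p∪q K _))))
                  (monotone (λ y∈⁅f⁆ → x∈p∩q⁺ (x∈p⇒⁅x⁆⊆p f∈K y∈⁅f⁆ , q⊆p∪q ⁅ e ⁆ ⁅ f ⁆ y∈⁅f⁆))) ⟩
    ρ S (K ∪ (⁅ e ⁆ ∪ ⁅ f ⁆)) + ρ S (K ∩ (⁅ e ⁆ ∪ ⁅ f ⁆))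
      ≤⟨ submodular K (⁅ e ⁆ ∪ ⁅ f ⁆) ⟩
    ρ S K + ρ S (⁅ e ⁆ ∪ ⁅ f ⁆)
      ≡⟨ cong (ρ S K +_) ρef≡1 ⟩
    ρ S K + 1 ∎)

  simplification-spans : ∀ {K} → IsSimplification S K → r S ≤ ρ S K
  simplification-spans {K} simple = begin
    ρ S (E S)      ≤⟨ monotone (q⊆p∪q K (E S)) ⟩
    ρ S (K ∪ E S)  ≤⟨ removal-induction Absorbed base step (E S) ⊆-refl ⟩
    ρ S K          ∎
    where
    Absorbed : Subset n → Set
    Absorbed Y = Y ⊆ E S → ρ S (K ∪ Y) ≤ ρ S K
    base : ∀ {Y} → Empty Y → Absorbed Y
    base ∅ _ = monotone (∪-lub ⊆-refl λ y∈Y → ⊥-elim (∅ (_ , y∈Y)))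
    step : ∀ {Y e} → e ∈ Y → Absorbed (Y - e) → Absorbed Y
    step {Y} {e} e∈Y ih Y⊆E = +-cancelʳ-≤ (ρ S K) _ _ (begin
      ρ S (K ∪ Y) + ρ S K
        ≤⟨ +-mono-≤ (monotone K∪Y⊆) (monotone (λ k → x∈p∩q⁺ (p⊆p∪q (Y - e) k , p⊆p∪q ⁅ e ⁆ k))) ⟩
      ρ S ((K ∪ (Y - e)) ∪ (K ∪ ⁅ e ⁆)) + ρ S ((K ∪ (Y - e)) ∩ (K ∪ ⁅ e ⁆))
        ≤⟨ submodular (K ∪ (Y - e)) (K ∪ ⁅ e ⁆) ⟩
      ρ S (K ∪ (Y - e)) + ρ S (K ∪ ⁅ e ⁆)
        ≤⟨ +-mono-≤ (ih (⊆-trans (p─q⊆p Y ⁅ e ⁆) Y⊆E)) (simplification-absorbs simple (Y⊆E e∈Y)) ⟩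
      ρ S K + ρ S K ∎)
      where
      K∪Y⊆ : K ∪ Y ⊆ (K ∪ (Y - e)) ∪ (K ∪ ⁅ e ⁆)
      K∪Y⊆ = ∪-lub (⊆-trans (p⊆p∪q (Y - e)) (p⊆p∪q _))
                   (⊆-trans (p⊆q∪[p─q] Y ⁅ e ⁆) (∪-lub (⊆-trans (q⊆p∪q K ⁅ e ⁆) (q⊆p∪q _ _))
                                                       (⊆-trans (q⊆p∪q K (Y - e)) (p⊆p∪q _))))

-- Three-connected rank systems

module ThreeConnectedProperties {S : RankSys n} (R : IsRankFunction (ρ S)) (3-conn : ThreeConnected S) where
  open IsRankFunction R

  singleton-separation : 2 ≤ ∣ E S ∣ → ∀ {e} → e ∈ E S → ρ S ⁅ e ⁆ ≡ 1 × ρ S (E S - e) ≡ r S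
  singleton-separation 2≤∣E∣ {e} e∈E = sum-tight (ρ⁅x⁆≤1 e) (monotone (p─q⊆p (E S) ⁅ e ⁆)) (begin
    1 + r S                      ≡⟨ +-comm 1 (r S) ⟩
    r S + 1                      ≤⟨ 3-conn ⁅ e ⁆ (x∈p⇒⁅x⁆⊆p e∈E) 1 ≤-refl (s≤s z≤n)
                                      (≤-reflexive (sym (∣⁅x⁆∣≡1 e)))
                                      (≤-pred (subst (2 ≤_) (x∈p⇒∣p∣≡1+∣p-x∣ e∈E) 2≤∣E∣)) ⟩
    ρ S ⁅ e ⁆ + ρ S (E S - e)    ∎)
    where open ≤-Reasoning

  r-positive : 2 ≤ ∣ E S ∣ → 1 ≤ r S
  r-positive 2≤∣E∣ with 1≤∣p∣⇒Nonempty (≤-trans (s≤s z≤n) 2≤∣E∣)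
  ... | e , e∈E = subst (_≤ r S) (proj₁ (singleton-separation 2≤∣E∣ e∈E)) (monotone (x∈p⇒⁅x⁆⊆p e∈E))

  r<∣E∣ : 2 ≤ ∣ E S ∣ → r S < ∣ E S ∣
  r<∣E∣ 2≤∣E∣ with 1≤∣p∣⇒Nonempty (≤-trans (s≤s z≤n) 2≤∣E∣)
  ... | e , e∈E = subst₂ _<_ (proj₂ (singleton-separation 2≤∣E∣ e∈E)) (sym (x∈p⇒∣p∣≡1+∣p-x∣ e∈E))
                         (s≤s (bounded (E S - e)))

  small-separation : 4 ≤ ∣ E S ∣ → ∀ {X} → X ⊆ E S → 1 ≤ ∣ X ∣ → ∣ X ∣ ≤ 2 →
    r S + ∣ X ∣ ≤ ρ S X + ρ S (E S ─ X)
  small-separation 4≤∣E∣ {X} X⊆E 1≤∣X∣ ∣X∣≤2 = 3-conn X X⊆E ∣ X ∣ 1≤∣X∣ ∣X∣≤2 ≤-refl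
    (≤-trans ∣X∣≤2 (+-cancelˡ-≤ 2 2 _ (begin
      4                       ≤⟨ 4≤∣E∣ ⟩
      ∣ E S ∣                 ≡⟨ ∣p∣≡∣q∣+∣p─q∣ (E S) X X⊆E ⟩
      ∣ X ∣ + ∣ E S ─ X ∣     ≤⟨ +-monoˡ-≤ _ ∣X∣≤2 ⟩
      2 + ∣ E S ─ X ∣         ∎)))
    where open ≤-Reasoning

  record Hyperplane : Set where
    field
      H                : Subset n
      H⊆E              : H ⊆ E S
      rank-drop        : suc (ρ S H) ≡ r S
      spanning         : ∀ {e} → e ∈ E S → e ∉ H → ρ S (H ∪ ⁅ e ⁆) ≡ r S
      large-complement : 3 ≤ ∣ E S ─ H ∣

    ρ[X∪H]≡∣X∣⊓1+ρH : ∀ X → X ⊆ E S ─ H → ρ S (X ∪ H) ≡ ∣ X ∣ ⊓ 1 + ρ S H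
    ρ[X∪H]≡∣X∣⊓1+ρH X X⊆E─H with nonempty? X
    ... | no ∅ = begin
      ρ S (X ∪ H)         ≡⟨ ≤-antisym (monotone (∪-lub (λ x∈ → ⊥-elim (∅ (_ , x∈))) ⊆-refl))
                                       (monotone (q⊆p∪q X H)) ⟩
      ρ S H               ≡⟨ cong (λ s → s ⊓ 1 + ρ S H) (Empty⇒∣p∣≡0 ∅) ⟨
      ∣ X ∣ ⊓ 1 + ρ S H   ∎
      where open ≡-Reasoning
    ... | yes (x , x∈X) with x∈p─q⁻ (E S) H (X⊆E─H x∈X)
    ...   | x∈E , x∉H = begin
      ρ S (X ∪ H)         ≡⟨ ≤-antisym (monotone (∪-lub (⊆-trans X⊆E─H (p─q⊆p (E S) H)) H⊆E))
                                       (subst (_≤ ρ S (X ∪ H)) (spanning x∈E x∉H)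
                                              (monotone (∪-lub (q⊆p∪q X H) (⊆-trans (x∈p⇒⁅x⁆⊆p x∈X) (p⊆p∪q H))))) ⟩
      r S                 ≡⟨ rank-drop ⟨
      1 + ρ S H           ≡⟨ cong (_+ ρ S H) (m≥n⇒m⊓n≡n (subst (1 ≤_) (sym (x∈p⇒∣p∣≡1+∣p-x∣ x∈X)) (s≤s z≤n))) ⟨
      ∣ X ∣ ⊓ 1 + ρ S H   ∎
      where open ≡-Reasoning

  record Circuit : Set where
    field
      Z         : Subset n
      Z⊆E       : Z ⊆ E S
      dependent : ρ S Z < ∣ Z ∣
      minimal   : ∀ {z} → z ∈ Z → ρ S (Z - z) ≡ ∣ Z - z ∣
      large     : 3 ≤ ∣ Z ∣

    proper-subset-independent : ∀ {Y z} → Y ⊆ Z → z ∈ Z → z ∉ Y → ρ S Y ≡ ∣ Y ∣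
    proper-subset-independent Y⊆Z z∈Z z∉Y = independent-⊆ (minimal z∈Z) (p⊆q∧x∉p⇒p⊆q-x Y⊆Z z∉Y)

    suc[ρZ]≡∣Z∣ : suc (ρ S Z) ≡ ∣ Z ∣
    suc[ρZ]≡∣Z∣ with 1≤∣p∣⇒Nonempty (≤-trans (s≤s z≤n) large)
    ... | z , z∈Z = ≤-antisym dependent (begin
      ∣ Z ∣              ≡⟨ x∈p⇒∣p∣≡1+∣p-x∣ z∈Z ⟩
      suc ∣ Z - z ∣      ≡⟨ cong suc (minimal z∈Z) ⟨
      suc (ρ S (Z - z))  ≤⟨ s≤s (monotone (p─q⊆p Z ⁅ z ⁆)) ⟩
      suc (ρ S Z)        ∎)
      where open ≤-Reasoning

    ρ[Z─T]≡∣Z─T∣ : ∀ {T} → T ⊆ Z → Nonempty T → ρ S (Z ─ T) ≡ ∣ Z ─ T ∣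
    ρ[Z─T]≡∣Z─T∣ {T} T⊆Z (t , t∈T) =
      proper-subset-independent (p─q⊆p Z T) (T⊆Z t∈T) λ t∈Z─T → proj₂ (x∈p─q⁻ Z T t∈Z─T) t∈T

    ρ[X∪[Z─T]]≡∣X∣⊓k+ρ[Z─T] : ∀ {T k} → T ⊆ Z → ∣ T ∣ ≡ suc k → ∀ X → X ⊆ T →
      ρ S (X ∪ (Z ─ T)) ≡ ∣ X ∣ ⊓ k + ρ S (Z ─ T)
    ρ[X∪[Z─T]]≡∣X∣⊓k+ρ[Z─T] {T} {k} T⊆Z ∣T∣≡1+k X X⊆T with nonempty? (T ─ X)
    ... | no ∅ = suc-injective (begin
      suc (ρ S (X ∪ (Z ─ T)))          ≡⟨ cong (λ Y → suc (ρ S Y)) X∪[Z─T]≡Z ⟩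
      suc (ρ S Z)                      ≡⟨ suc[ρZ]≡∣Z∣ ⟩
      ∣ Z ∣                            ≡⟨ ∣p∣≡∣q∣+∣p─q∣ Z T T⊆Z ⟩
      ∣ T ∣ + ∣ Z ─ T ∣                ≡⟨ cong₂ _+_ ∣T∣≡1+k (sym (ρ[Z─T]≡∣Z─T∣ T⊆Z T-nonempty)) ⟩
      suc k + ρ S (Z ─ T)              ≡⟨ cong (λ s → suc (s + ρ S (Z ─ T))) (m≥n⇒m⊓n≡n (n≤1+n k)) ⟨
      suc (suc k ⊓ k + ρ S (Z ─ T))    ≡⟨ cong (λ s → suc (s ⊓ k + ρ S (Z ─ T))) (trans (cong ∣_∣ X≡T) ∣T∣≡1+k) ⟨
      suc (∣ X ∣ ⊓ k + ρ S (Z ─ T))    ∎)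
      where
      open ≡-Reasoning
      T-nonempty : Nonempty T
      T-nonempty = 1≤∣p∣⇒Nonempty (subst (1 ≤_) (sym ∣T∣≡1+k) (s≤s z≤n))
      X≡T : X ≡ T
      X≡T = ⊆-antisym X⊆T (Empty[p─q]⇒p⊆q ∅)
      X∪[Z─T]≡Z : X ∪ (Z ─ T) ≡ Z
      X∪[Z─T]≡Z = ⊆-antisym (∪-lub (⊆-trans X⊆T T⊆Z) (p─q⊆p Z T))
        (⊆-trans (p⊆q∪[p─q] Z T) (∪-lub (λ x∈T → p⊆p∪q (Z ─ T) (subst (_ ∈_) (sym X≡T) x∈T)) (q⊆p∪q X (Z ─ T))))
    ... | yes (t , t∈T─X) with x∈p─q⁻ T X t∈T─X
    ...   | t∈T , t∉X = begin
      ρ S (X ∪ (Z ─ T))            ≡⟨ proper-subset-independent (∪-lub (⊆-trans X⊆T T⊆Z) (p─q⊆p Z T)) (T⊆Z t∈T)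
                                        (λ t∈ → [ t∉X , (λ t∈Z─T → proj₂ (x∈p─q⁻ Z T t∈Z─T) t∈T) ]
                                                  (x∈p∪q⁻ X (Z ─ T) t∈)) ⟩
      ∣ X ∪ (Z ─ T) ∣              ≡⟨ ∣p∪q∣≡∣p∣+∣q∣ X (Z ─ T) (λ x∈X x∈Z─T → proj₂ (x∈p─q⁻ Z T x∈Z─T) (X⊆T x∈X)) ⟩
      ∣ X ∣ + ∣ Z ─ T ∣             ≡⟨ cong₂ _+_ (m≤n⇒m⊓n≡m ∣X∣≤k) (ρ[Z─T]≡∣Z─T∣ T⊆Z (t , t∈T)) ⟨
      ∣ X ∣ ⊓ k + ρ S (Z ─ T)      ∎
      where
      open ≡-Reasoning
      ∣X∣≤k : ∣ X ∣ ≤ k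
      ∣X∣≤k = ≤-trans (p⊆q⇒∣p∣≤∣q∣ (p⊆q∧x∉p⇒p⊆q-x X⊆T t∉X))
                      (≤-reflexive (suc-injective (trans (sym (x∈p⇒∣p∣≡1+∣p-x∣ t∈T)) ∣T∣≡1+k)))

  hyperplane-with-large-complement : 4 ≤ ∣ E S ∣ → Hyperplane
  hyperplane-with-large-complement 4≤∣E∣
    with maximal-subset (λ H → ρ S H < r S) (λ H → ρ S H <? r S) {Y = ⊥} (λ x∈⊥ → ⊥-elim (∉⊥ x∈⊥))
           (subst (_< r S) (sym ρ⊥≡0) (r-positive (≤-trans (s≤s (s≤s z≤n)) 4≤∣E∣)))
  ... | H , H⊆E , ρH<r , maximal = record
    { H = H ; H⊆E = H⊆E ; rank-drop = rank-drop ; spanning = spanning ; large-complement = 3≤∣E─H∣ }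
    where
    spanning : ∀ {e} → e ∈ E S → e ∉ H → ρ S (H ∪ ⁅ e ⁆) ≡ r S
    spanning e∈E e∉H = ≤-antisym (monotone (∪-lub H⊆E (x∈p⇒⁅x⁆⊆p e∈E))) (≮⇒≥ (maximal e∈E e∉H))
    E─H-nonempty : Nonempty (E S ─ H)
    E─H-nonempty with nonempty? (E S ─ H)
    ... | yes ne = ne
    ... | no ∅ = ⊥-elim (<⇒≱ ρH<r (monotone (Empty[p─q]⇒p⊆q ∅)))
    rank-drop : suc (ρ S H) ≡ r S
    rank-drop with E─H-nonempty
    ... | e , e∈E─H with x∈p─q⁻ (E S) H e∈E─H
    ... | e∈E , e∉H = ≤-antisym ρH<r (begin
      r S                   ≡⟨ spanning e∈E e∉H ⟨
      ρ S (H ∪ ⁅ e ⁆)       ≤⟨ ρ[X∪x]≤ρX+1 H e ⟩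
      ρ S H + 1             ≡⟨ +-comm (ρ S H) 1 ⟩
      suc (ρ S H)           ∎)
      where open ≤-Reasoning
    3≤∣E─H∣ : 3 ≤ ∣ E S ─ H ∣
    3≤∣E─H∣ = ≮⇒≥ λ ∣E─H∣<3 → <⇒≱ ρH<r (+-cancelʳ-≤ ∣ E S ─ H ∣ _ _ (begin
      r S + ∣ E S ─ H ∣                    ≤⟨ small-separation 4≤∣E∣ (p─q⊆p (E S) H) 1≤∣E─H∣ (≤-pred ∣E─H∣<3) ⟩
      ρ S (E S ─ H) + ρ S (E S ─ (E S ─ H)) ≤⟨ +-mono-≤ (bounded (E S ─ H)) (≤-reflexive (cong (ρ S) (p─[p─q]≡q H⊆E))) ⟩
      ∣ E S ─ H ∣ + ρ S H                  ≡⟨ +-comm ∣ E S ─ H ∣ (ρ S H) ⟩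
      ρ S H + ∣ E S ─ H ∣                  ∎))
      where
      open ≤-Reasoning
      1≤∣E─H∣ : 1 ≤ ∣ E S ─ H ∣
      1≤∣E─H∣ = subst (1 ≤_) (sym (x∈p⇒∣p∣≡1+∣p-x∣ (proj₂ E─H-nonempty))) (s≤s z≤n)

  large-circuit : 4 ≤ ∣ E S ∣ → Circuit
  large-circuit 4≤∣E∣ with minimal-subset (λ Z → ρ S Z < ∣ Z ∣) (λ Z → ρ S Z <? ∣ Z ∣)
                                  (r<∣E∣ (≤-trans (s≤s (s≤s z≤n)) 4≤∣E∣))
  ... | Z , Z⊆E , dependent , minimal =
    record { Z = Z ; Z⊆E = Z⊆E ; dependent = dependent
           ; minimal = λ z∈Z → ≤-antisym (bounded _) (≮⇒≥ (minimal z∈Z)) ; large = 3≤∣Z∣ }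
    where
    3≤∣Z∣ : 3 ≤ ∣ Z ∣
    3≤∣Z∣ = ≮⇒≥ λ ∣Z∣<3 → <⇒≱ dependent (+-cancelˡ-≤ (r S) _ _ (begin
      r S + ∣ Z ∣            ≤⟨ small-separation 4≤∣E∣ Z⊆E (≤-trans (s≤s z≤n) dependent) (≤-pred ∣Z∣<3) ⟩
      ρ S Z + ρ S (E S ─ Z)  ≤⟨ +-monoʳ-≤ (ρ S Z) (monotone (p─q⊆p (E S) Z)) ⟩
      ρ S Z + r S            ≡⟨ +-comm (ρ S Z) (r S) ⟩
      r S + ρ S Z            ∎))
      where open ≤-Reasoning

-- Uniform minors

image : (Fin m → Fin n) → Subset n
image {zero} f = ⊥
image {suc m} f = ⁅ f zero ⁆ ∪ image (f ∘ suc)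

f[i]∈image : ∀ (f : Fin m → Fin n) i → f i ∈ image f
f[i]∈image f zero = p⊆p∪q _ (x∈⁅x⁆ (f zero))
f[i]∈image f (suc i) = q⊆p∪q _ _ (f[i]∈image (f ∘ suc) i)

∈-image⁻ : ∀ (f : Fin m → Fin n) {y} → y ∈ image f → ∃ λ i → f i ≡ y
∈-image⁻ {zero} f y∈ = ⊥-elim (∉⊥ y∈)
∈-image⁻ {suc m} f y∈ with x∈p∪q⁻ ⁅ f zero ⁆ _ y∈
... | inj₁ y∈⁅f0⁆ = zero , sym (x∈⁅y⁆⇒x≡y _ y∈⁅f0⁆)
... | inj₂ y∈rest with ∈-image⁻ (f ∘ suc) y∈rest
...   | i , fi≡y = suc i , fi≡y

record InjectionInto (m : ℕ) (P : Subset n) : Set where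
  field
    f         : Fin m → Fin n
    injective : Injective _≡_ _≡_ f
    image⊆    : image f ⊆ P

injection-into : ∀ m (P : Subset n) → m ≤ ∣ P ∣ → InjectionInto m P
injection-into zero P _ = record { f = λ () ; injective = λ { {()} } ; image⊆ = λ x∈⊥ → ⊥-elim (∉⊥ x∈⊥) }
injection-into (suc m) P m<∣P∣ with 1≤∣p∣⇒Nonempty (≤-trans (s≤s z≤n) m<∣P∣)
... | e , e∈P = record
  { f = e Vecᶠ.∷ g ; injective = inj ; image⊆ = ∪-lub (x∈p⇒⁅x⁆⊆p e∈P) (⊆-trans image-g⊆P-e (p─q⊆p P ⁅ e ⁆)) }
  where
  open InjectionInto (injection-into m (P - e) (≤-pred (subst (suc m ≤_) (x∈p⇒∣p∣≡1+∣p-x∣ {p = P} e∈P) m<∣P∣)))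
    renaming (f to g; injective to g-inj; image⊆ to image-g⊆P-e)
  g≢e : ∀ j → g j ≢ e
  g≢e j gj≡e = proj₂ (x∈p─q⁻ P ⁅ e ⁆ (image-g⊆P-e (f[i]∈image g j))) (subst (_∈ ⁅ e ⁆) (sym gj≡e) (x∈⁅x⁆ e))
  inj : Injective _≡_ _≡_ (e Vecᶠ.∷ g)
  inj {zero} {zero} _ = refl
  inj {zero} {suc j} e≡gj = ⊥-elim (g≢e j (sym e≡gj))
  inj {suc i} {zero} gi≡e = ⊥-elim (g≢e i gi≡e)
  inj {suc i} {suc j} gi≡gj = cong suc (g-inj gi≡gj)

module _ (f : Fin m → Fin n) where

  ∈-preimage⁻ : ∀ {X i} → i ∈ preimage f X → f i ∈ X
  ∈-preimage⁻ {X} {i} i∈ = lookup⇒[]= (f i) X (trans (sym (lookup∘tabulate _ i)) ([]=⇒lookup i∈))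

  ∈-preimage⁺ : ∀ {X i} → f i ∈ X → i ∈ preimage f X
  ∈-preimage⁺ {X} {i} fi∈X = lookup⇒[]= i (preimage f X) (trans (lookup∘tabulate _ i) ([]=⇒lookup fi∈X))

  module _ (f-inj : Injective _≡_ _≡_ f) where

    preimage-remove : ∀ X i → preimage f X - i ≡ preimage f (X - f i)
    preimage-remove X i = ⊆-antisym
      (λ j∈ → let j∈pre , j∉⁅i⁆ = x∈p─q⁻ (preimage f X) ⁅ i ⁆ j∈ in
        ∈-preimage⁺ {X - f i} (x∈p∧x∉q⇒x∈p─q (∈-preimage⁻ j∈pre) (λ fj∈ → j∉⁅i⁆ (x≡y⇒x∈⁅y⁆ (f-inj (x∈⁅y⁆⇒x≡y _ fj∈))))))
      (λ j∈ → let fj∈X , fj∉⁅fi⁆ = x∈p─q⁻ X ⁅ f i ⁆ (∈-preimage⁻ j∈) in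
        x∈p∧x∉q⇒x∈p─q (∈-preimage⁺ fj∈X) (λ j∈⁅i⁆ → fj∉⁅fi⁆ (x≡y⇒x∈⁅y⁆ (cong f (x∈⁅y⁆⇒x≡y _ j∈⁅i⁆)))))

    ∣preimage∣≡∣X∣ : ∀ X → X ⊆ image f → ∣ preimage f X ∣ ≡ ∣ X ∣
    ∣preimage∣≡∣X∣ = removal-induction (λ X → X ⊆ image f → ∣ preimage f X ∣ ≡ ∣ X ∣) base step
      where
      base : ∀ {X} → Empty X → X ⊆ image f → ∣ preimage f X ∣ ≡ ∣ X ∣
      base ∅ _ = trans (Empty⇒∣p∣≡0 λ { (i , i∈) → ∅ (f i , ∈-preimage⁻ i∈) }) (sym (Empty⇒∣p∣≡0 ∅))
      step : ∀ {X y} → y ∈ X → (X - y ⊆ image f → ∣ preimage f (X - y) ∣ ≡ ∣ X - y ∣) →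
             X ⊆ image f → ∣ preimage f X ∣ ≡ ∣ X ∣
      step {X} y∈X ih X⊆image with ∈-image⁻ f (X⊆image y∈X)
      ... | i , refl = begin
        ∣ preimage f X ∣              ≡⟨ x∈p⇒∣p∣≡1+∣p-x∣ (∈-preimage⁺ y∈X) ⟩
        suc ∣ preimage f X - i ∣      ≡⟨ cong (λ s → suc ∣ s ∣) (preimage-remove X i) ⟩
        suc ∣ preimage f (X - f i) ∣  ≡⟨ cong suc (ih (⊆-trans (p─q⊆p X _) X⊆image)) ⟩
        suc ∣ X - f i ∣               ≡⟨ x∈p⇒∣p∣≡1+∣p-x∣ y∈X ⟨
        ∣ X ∣                         ∎
        where open ≡-Reasoning

∣image∣≡m : ∀ (f : Fin m → Fin n) → Injective _≡_ _≡_ f → ∣ image f ∣ ≡ m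
∣image∣≡m {m} f f-inj = begin
  ∣ image f ∣                    ≡⟨ ∣preimage∣≡∣X∣ f f-inj (image f) ⊆-refl ⟨
  ∣ preimage f (image f) ∣       ≡⟨ cong ∣_∣ (⊆-antisym ⊆⊤ λ {i} _ → ∈-preimage⁺ f (f[i]∈image f i)) ⟩
  ∣ ⊤ {m} ∣                      ≡⟨ ∣⊤∣≡n m ⟩
  m                              ∎
  where open ≡-Reasoning

Uniform : ℕ → Matroid m → Set
Uniform k N = ∀ Y → rank N Y ≡ ∣ Y ∣ ⊓ k

uniform-minor : ∀ (S : RankSys n) (N : Matroid m) {k} → Uniform k N →
  (C : Subset n) (f : Fin m → Fin n) → Injective _≡_ _≡_ f → C ⊆ E S → image f ⊆ E S ─ C →
  (∀ X → X ⊆ image f → ρ S (X ∪ C) ≡ ∣ X ∣ ⊓ k + ρ S C) → HasMinor S N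
uniform-minor {n = n} S N {k} uniform C f f-inj C⊆E T⊆E─C ρ[X∪C] =
  C , D , C⊆E , p─q⊆p (E S) (C ∪ T) , C-D-disjoint , f , f-inj ,
  (λ i → T⊆E─[C∪D] (f[i]∈image f i)) , (λ e e∈ → ∈-image⁻ f (E─[C∪D]⊆T e∈)) , rank-agrees
  where
  T D : Subset n
  T = image f
  D = E S ─ (C ∪ T)
  C-D-disjoint : ∀ e → e ∈ C → e ∉ D
  C-D-disjoint e e∈C e∈D = proj₂ (x∈p─q⁻ (E S) (C ∪ T) e∈D) (p⊆p∪q T e∈C)
  E─[C∪D]⊆T : E S ─ (C ∪ D) ⊆ T
  E─[C∪D]⊆T {e} e∈ with x∈p─q⁻ (E S) (C ∪ D) e∈ | e ∈? T
  ... | _ | yes e∈T = e∈T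
  ... | e∈E , e∉C∪D | no e∉T = ⊥-elim (e∉C∪D (q⊆p∪q C D (x∈p∧x∉q⇒x∈p─q e∈E λ e∈C∪T →
        [ (λ e∈C → e∉C∪D (p⊆p∪q D e∈C)) , e∉T ] (x∈p∪q⁻ C T e∈C∪T))))
  T⊆E─[C∪D] : T ⊆ E S ─ (C ∪ D)
  T⊆E─[C∪D] e∈T with x∈p─q⁻ (E S) C (T⊆E─C e∈T)
  ... | e∈E , e∉C = x∈p∧x∉q⇒x∈p─q e∈E λ e∈C∪D →
        [ e∉C , (λ e∈D → proj₂ (x∈p─q⁻ (E S) (C ∪ T) e∈D) (q⊆p∪q C T e∈T)) ] (x∈p∪q⁻ C D e∈C∪D)
  rank-agrees : ∀ X → X ⊆ E S ─ (C ∪ D) → rank N (preimage f X) + ρ S C ≡ ρ S (X ∪ C)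
  rank-agrees X X⊆ = begin
    rank N (preimage f X) + ρ S C    ≡⟨ cong (_+ ρ S C) (uniform (preimage f X)) ⟩
    ∣ preimage f X ∣ ⊓ k + ρ S C     ≡⟨ cong (λ s → s ⊓ k + ρ S C) (∣preimage∣≡∣X∣ f f-inj X X⊆T) ⟩
    ∣ X ∣ ⊓ k + ρ S C                ≡⟨ ρ[X∪C] X X⊆T ⟨
    ρ S (X ∪ C)                      ∎
    where
    open ≡-Reasoning
    X⊆T : X ⊆ T
    X⊆T = ⊆-trans X⊆ E─[C∪D]⊆T

-- Three-connected matroids on at most three elements

module SmallThreeConnected (N : Matroid m) (3-conn : ThreeConnected (toSys N)) (2≤m : 2 ≤ m) where
  open ThreeConnectedProperties (matroid-isRankFunction N) 3-conn

  point : ∀ e → rank N ⁅ e ⁆ ≡ 1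
  point e = proj₁ (singleton-separation (subst (2 ≤_) (sym (∣⊤∣≡n m)) 2≤m) ∈⊤)

  copoint : ∀ e → rank N (⊤ - e) ≡ rank N ⊤
  copoint e = proj₂ (singleton-separation (subst (2 ≤_) (sym (∣⊤∣≡n m)) 2≤m) ∈⊤)

three-point-uniform : ∀ (N : Matroid 3) → ThreeConnected (toSys N) → ∀ {k} →
  1 ⊓ k ≡ 1 → 2 ⊓ k ≡ rank N ⊤ → 3 ⊓ k ≡ rank N ⊤ → Uniform k N
three-point-uniform N 3-conn points lines plane = λ
  { (false ∷ false ∷ false ∷ []) → n≤0⇒n≡0 (rank-bound N _)
  ; (true ∷ false ∷ false ∷ [])  → trans (point zero) (sym points)
  ; (false ∷ true ∷ false ∷ [])  → trans (point (suc zero)) (sym points)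
  ; (false ∷ false ∷ true ∷ [])  → trans (point (suc (suc zero))) (sym points)
  ; (false ∷ true ∷ true ∷ [])   → trans (copoint zero) (sym lines)
  ; (true ∷ false ∷ true ∷ [])   → trans (copoint (suc zero)) (sym lines)
  ; (true ∷ true ∷ false ∷ [])   → trans (copoint (suc (suc zero))) (sym lines)
  ; (true ∷ true ∷ true ∷ [])    → sym plane
  }
  where open SmallThreeConnected N 3-conn (s≤s (s≤s z≤n))

small-threeConnected-uniform : ∀ {k} (N : Matroid (suc k)) → ThreeConnected (toSys N) → k ≤ 2 →
  Uniform 1 N ⊎ Uniform k N
small-threeConnected-uniform {zero} N _ _ with rank N ⊤ in ρ⊤ | rank-bound N ⊤
... | 0 | _ = inj₂ λ { (true ∷ []) → ρ⊤ ; (false ∷ []) → n≤0⇒n≡0 (rank-bound N _) }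
... | 1 | _ = inj₁ λ { (true ∷ []) → ρ⊤ ; (false ∷ []) → n≤0⇒n≡0 (rank-bound N _) }
... | suc (suc _) | s≤s ()
small-threeConnected-uniform {suc zero} N 3-conn _ = inj₁ λ
  { (false ∷ false ∷ []) → n≤0⇒n≡0 (rank-bound N _)
  ; (true ∷ false ∷ [])  → point zero
  ; (false ∷ true ∷ [])  → point (suc zero)
  ; (true ∷ true ∷ [])   → trans (sym (copoint zero)) (point (suc zero))
  }
  where open SmallThreeConnected N 3-conn ≤-refl
small-threeConnected-uniform {suc (suc zero)} N 3-conn _ with rank N ⊤ in ρ⊤ | ρ⊤≥1 | ρ⊤≤2
  where
  open SmallThreeConnected N 3-conn (s≤s (s≤s z≤n))
  ρ⊤≥1 : 1 ≤ rank N ⊤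
  ρ⊤≥1 = subst (_≤ rank N ⊤) (point zero) (rank-mono N ⊆⊤)
  ρ⊤≤2 : rank N ⊤ ≤ 2
  ρ⊤≤2 = subst (_≤ 2) (copoint zero) (rank-bound N (⊤ - zero))
... | 0 | () | _
... | 1 | _ | _ = inj₁ (three-point-uniform N 3-conn refl (sym ρ⊤) (sym ρ⊤))
... | 2 | _ | _ = inj₂ (three-point-uniform N 3-conn refl (sym ρ⊤) (sym ρ⊤))
... | suc (suc (suc _)) | _ | s≤s (s≤s ())
small-threeConnected-uniform {suc (suc (suc _))} N _ (s≤s (s≤s ()))

module LargeThreeConnected {S : RankSys n} (R : IsRankFunction (ρ S)) (3-conn : ThreeConnected S)
                           (4≤∣E∣ : 4 ≤ ∣ E S ∣) where
  open ThreeConnectedProperties R 3-conn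

  rank-one-uniform-minor : ∀ (N : Matroid m) → m ≤ 3 → Uniform 1 N → HasMinor S N
  rank-one-uniform-minor {m} N m≤3 uniform = uniform-minor S N uniform H f injective H⊆E image⊆
                                       (λ X X⊆T → ρ[X∪H]≡∣X∣⊓1+ρH X (⊆-trans X⊆T image⊆))
    where
    open Hyperplane (hyperplane-with-large-complement 4≤∣E∣)
    open InjectionInto (injection-into m (E S ─ H) (≤-trans m≤3 large-complement))

  circuit-uniform-minor : ∀ {k} (N : Matroid (suc k)) → suc k ≤ 3 → Uniform k N → HasMinor S N
  circuit-uniform-minor {k} N k<3 uniform = uniform-minor S N uniform (Z ─ T) f injective
    (⊆-trans (p─q⊆p Z T) Z⊆E)
    (λ x∈T → x∈p∧x∉q⇒x∈p─q (Z⊆E (image⊆ x∈T)) λ x∈Z─T → proj₂ (x∈p─q⁻ Z T x∈Z─T) x∈T)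
    (ρ[X∪[Z─T]]≡∣X∣⊓k+ρ[Z─T] image⊆ (∣image∣≡m f injective))
    where
    open Circuit (large-circuit 4≤∣E∣)
    open InjectionInto (injection-into (suc k) Z (≤-trans k<3 large))
    T : Subset n
    T = image f

  small-threeConnected-minor : ∀ {m} (N : Matroid m) → ThreeConnected (toSys N) → m ≤ 3 → HasMinor S N
  small-threeConnected-minor {zero} N _ _ = rank-one-uniform-minor N z≤n λ { [] → n≤0⇒n≡0 (rank-bound N []) }
  small-threeConnected-minor {suc k} N N-3-conn (s≤s k≤2) with small-threeConnected-uniform N N-3-conn k≤2
  ... | inj₁ uniform = rank-one-uniform-minor N (s≤s k≤2) uniform
  ... | inj₂ uniform = circuit-uniform-minor N (s≤s k≤2) uniform

-- Elastic elements

simplification-large : ∀ {S : RankSys n} {K} → IsRankFunction (ρ S) → 3 ≤ r S →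
  IsSimplification S K → ThreeConnected (si S K) → 4 ≤ ∣ E (si S K) ∣
simplification-large {S = S} {K} R 3≤r simple 3-conn = begin
  4                            ≤⟨ s≤s (≤-trans 3≤r (simplification-spans R simple)) ⟩
  suc (ρ S K)                  ≡⟨ cong (λ X → suc (ρ S X)) (p─[p─q]≡q (proj₁ simple)) ⟨
  suc (r (si S K))             ≤⟨ r<∣E∣ (≤-trans (s≤s (s≤s z≤n)) 3≤∣E∣) ⟩
  ∣ E (si S K) ∣               ∎
  where
  open ≤-Reasoning
  open IsRankFunction R
  open ThreeConnectedProperties {S = si S K} R 3-conn
  3≤∣E∣ : 3 ≤ ∣ E (si S K) ∣
  3≤∣E∣ = ≤-trans 3≤r (≤-trans (simplification-spans R simple)
                               (≤-trans (≤-reflexive (cong (ρ S) (sym (p─[p─q]≡q (proj₁ simple))))) (bounded _)))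

-- |K| is the sum of the corank ρ*(K) ≥ r(S*) of co(S) and its rank, which is positive.
cosimplification-large : ∀ {S : RankSys n} {K} → IsRankFunction (ρ S) → 3 ≤ r (dual S) →
  IsCosimplification S K → ThreeConnected (co S K) → 4 ≤ ∣ E (co S K) ∣
cosimplification-large {n} {S} {K} R 3≤r* cosimple 3-conn = begin
  4                                              ≤⟨ +-mono-≤ 3≤ρ*K (r-positive (≤-trans (s≤s (s≤s z≤n)) 3≤∣E∣)) ⟩
  ρ (dual S) K + r (co S K)                      ≤⟨ +-monoʳ-≤ (ρ (dual S) K)
                                                      (∸-monoˡ-≤ (ρ S C) (monotone (∪-lub (p─q⊆p (E S) C) (p─q⊆p (E S) K)))) ⟩
  (∣ K ∣ + ρ S C ∸ r S) + (r S ∸ ρ S C)          ≡⟨ ∸-telescope (monotone (p─q⊆p (E S) K)) (ρE≤∣X∣+ρ[E─X] (E S) K) ⟩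
  ∣ K ∣                                          ≡⟨ cong ∣_∣ (p─[p─q]≡q (proj₁ cosimple)) ⟨
  ∣ E (co S K) ∣                                 ∎
  where
  open ≤-Reasoning
  open IsRankFunction R
  open ThreeConnectedProperties {S = co S K} (contraction-isRankFunction R (E S ─ K)) 3-conn
  C : Subset n
  C = E S ─ K
  R* : IsRankFunction (ρ (dual S))
  R* = dual-isRankFunction R (E S)
  3≤ρ*K : 3 ≤ ρ (dual S) K
  3≤ρ*K = ≤-trans 3≤r* (simplification-spans R* cosimple)
  3≤∣E∣ : 3 ≤ ∣ E (co S K) ∣
  3≤∣E∣ = subst (3 ≤_) (cong ∣_∣ (sym (p─[p─q]≡q (proj₁ cosimple)))) (≤-trans 3≤ρ*K (IsRankFunction.bounded R* K))

module _ (M : Matroid n) (x : Fin n) where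

  contraction-rank≥3 : 4 ≤ r (toSys M) → 3 ≤ r (contract ⁅ x ⁆ (toSys M))
  contraction-rank≥3 4≤r = begin
    3                                        ≤⟨ ∸-mono 4≤r (ρ⁅x⁆≤1 x) ⟩
    rank M ⊤ ∸ rank M ⁅ x ⁆                   ≤⟨ ∸-monoˡ-≤ (rank M ⁅ x ⁆) (monotone ⊤⊆[⊤-x]∪⁅x⁆) ⟩
    rank M ((⊤ - x) ∪ ⁅ x ⁆) ∸ rank M ⁅ x ⁆    ∎
    where
    open ≤-Reasoning
    open IsRankFunction (matroid-isRankFunction M)
    ⊤⊆[⊤-x]∪⁅x⁆ : ⊤ ⊆ (⊤ - x) ∪ ⁅ x ⁆
    ⊤⊆[⊤-x]∪⁅x⁆ = ⊆-trans (p⊆q∪[p─q] ⊤ ⁅ x ⁆) (∪-lub (q⊆p∪q _ _) (p⊆p∪q _))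

  deletion-corank≥3 : 4 ≤ r (dual (toSys M)) → 3 ≤ r (dual (delete ⁅ x ⁆ (toSys M)))
  deletion-corank≥3 4≤r* = ≤-pred (begin
    4                                        ≤⟨ 4≤r* ⟩
    ∣ ⊤ {n} ∣ + rank M (⊤ {n} ─ ⊤) ∸ rank M ⊤  ≤⟨ ∸-mono ∣⊤∣+ρ[⊤─⊤]≤1+∣⊤-x∣ (rank-mono M ⊆⊤) ⟩
    suc ∣ E′ ∣ ∸ rank M E′                    ≤⟨ 1+m∸n≤1+[m∸n] ∣ E′ ∣ (rank M E′) ⟩
    suc (∣ E′ ∣ ∸ rank M E′)                  ≤⟨ s≤s (∸-monoˡ-≤ (rank M E′) (m≤m+n _ _)) ⟩
    suc (∣ E′ ∣ + rank M (E′ ─ E′) ∸ rank M E′) ∎)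
    where
    open ≤-Reasoning
    E′ : Subset n
    E′ = ⊤ - x
    ∣⊤∣+ρ[⊤─⊤]≤1+∣⊤-x∣ : ∣ ⊤ {n} ∣ + rank M (⊤ {n} ─ ⊤) ≤ suc ∣ E′ ∣
    ∣⊤∣+ρ[⊤─⊤]≤1+∣⊤-x∣ = begin
      ∣ ⊤ {n} ∣ + rank M (⊤ {n} ─ ⊤) ≤⟨ +-monoʳ-≤ ∣ ⊤ {n} ∣ (rank-bound M (⊤ ─ ⊤)) ⟩
      ∣ ⊤ {n} ∣ + ∣ ⊤ {n} ─ ⊤ ∣     ≡⟨ cong (λ X → ∣ ⊤ {n} ∣ + ∣ X ∣) (p─⊤≡⊥ (⊤ {n})) ⟩
      ∣ ⊤ {n} ∣ + ∣ ⊥ {n} ∣         ≡⟨ cong (∣ ⊤ {n} ∣ +_) (∣⊥∣≡0 n) ⟩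
      ∣ ⊤ {n} ∣ + 0                ≡⟨ +-identityʳ ∣ ⊤ {n} ∣ ⟩
      ∣ ⊤ {n} ∣                    ≡⟨ x∈p⇒∣p∣≡1+∣p-x∣ {x = x} (∈⊤ {n}) ⟩
      suc ∣ E′ ∣                   ∎

lemma3p1 : ∀ {m n} (M : Matroid n) (N : Matroid m) →
    ThreeConnected (toSys M) →
    4 ≤ r (toSys M) → 4 ≤ r (dual (toSys M)) →
    ThreeConnected (toSys N) → HasMinor (toSys M) N → m ≤ 3 →
    (x : Fin n) → Elastic M x → NElastic N M x
lemma3p1 M N _ 4≤r 4≤r* N-3-conn _ m≤3 x ((K , simple , si-3-conn) , (K* , cosimple , co-3-conn)) =
  ( K , simple , si-3-conn
  , LargeThreeConnected.small-threeConnected-minor R/x si-3-conn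
      (simplification-large R/x (contraction-rank≥3 M x 4≤r) simple si-3-conn) N N-3-conn m≤3 ) ,
  ( K* , cosimple , co-3-conn
  , LargeThreeConnected.small-threeConnected-minor (contraction-isRankFunction R _) co-3-conn
      (cosimplification-large R (deletion-corank≥3 M x 4≤r*) cosimple co-3-conn) N N-3-conn m≤3 )
  where
  R : IsRankFunction (rank M)
  R = matroid-isRankFunction M
  R/x : IsRankFunction (ρ (contract ⁅ x ⁆ (toSys M)))
  R/x = contraction-isRankFunction R ⁅ x ⁆
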